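{- For all positive integers $n$ and $m$, $$Y_{1}(n,m;r)=G_{n}^{(s)}(m,r,1),\qquad Y_{2}(n,m;r)=G_{n}^{(c)}(m,r,1).$$
   Context: Graphs: $S_n$ is the path graph on vertices $v_1,\dots,v_n$ with edges $\{v_i,v_{i+1}\}$, $1\le i\le n-1$; $C_n$ is the graph on $v_1,\dots,v_n$ with edges $\{v_i,v_j\}$, $i<j$, $j-i\equiv \pm1 \pmod n$ (for $n\ge3$ the $n$-cycle, $C_2$ a single edge, $C_1$ no edges); $K_m$ is the complete graph on $m$ vertices; $\times$ is the Cartesian product of graphs. For $G_1(n,m)=S_n\times K_m$ and $G_2(n,m)=C_n\times K_m$, $Y_i(n,m;r)=\sum_{I}r^{|I|}$, the sum over all independent sets $I$ (sets of pairwise non-adjacent vertices, including $\emptyset$) of $G_i(n,m)$. For $S\subseteq\{1,\dots,n\}$ let $|S|$ be its size and $\sigma(S)=\sum_{i\in S}i$. Segment: with $c(S)$ the number of maximal runs of consecutive integers in $S$, $G_n^{(s)}(m,r,s)=\sum_{S} s^{\sigma(S)}r^{|S|}m^{c(S)}(m-1)^{|S|-c(S)}$. Circle: for $n\ge3$, regard positions cyclically and set $G_n^{(c)}(m,r,s)=\sum_{S} s^{\sigma(S)}r^{|S|}P_S(m)$, where $P_S(m)=m^{c_o(S)}(m-1)^{|S|-c_o(S)}$ for $S\neq\{1,\dots,n\}$ ($c_o(S)$ = number of maximal cyclic runs in $S$) and $P_S(m)=(m-1)^n+(-1)^n(m-1)$ for $S=\{1,\dots,n\}$; for $n\le2$,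 $G_n^{(c)}:=G_n^{(s)}$. -}

module Defs where

open import Data.Bool using (Bool; true; false; _∧_; _∨_; not; if_then_else_)
open import Data.Nat as ℕ using (ℕ; zero; suc; _∸_)
open import Data.Nat.Divisibility using (_∣?_)
open import Data.Fin as Fin using (Fin; toℕ)
open import Data.Fin.Properties using () renaming (_≟_ to _≟F_)
open import Data.Product using (_×_; _,_)
open import Data.List as List using (List; []; _∷_; allFin; concatMap; filter; map; foldr)
open import Data.Vec as Vec using (Vec; []; _∷_; lookup; toList)
open import Data.Integer as ℤ using (ℤ; +_; _+_; _*_; -_; _-_)
open import Relation.Nullary.Decidable using (⌊_⌋)

allVec : {A : Set} → List A → (k : ℕ) → List (Vec A k)
allVec xs zero    = [] ∷ []
allVec xs (suc k) = concatMap (λ x → map (x ∷_) (allVec xs k)) xs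

all : {A : Set} → (A → Bool) → List A → Bool
all p []       = true
all p (x ∷ xs) = p x ∧ all p xs

bools : List Bool
bools = false ∷ true ∷ []

sumℤ : List ℤ → ℤ
sumℤ = foldr _+_ (+ 0)

infixr 8 _^ℤ_
_^ℤ_ : ℤ → ℕ → ℤ
x ^ℤ zero  = + 1
x ^ℤ suc k = x * (x ^ℤ k)

countT : List Bool → ℕ
countT []           = 0
countT (true ∷ bs)  = suc (countT bs)
countT (false ∷ bs) = countT bs

Graph : ℕ → Set
Graph k = Fin k → Fin k → Bool

-- vertex v_{i+1} is represented by i : Fin n (0-indexed)

pathAdj : (n : ℕ) → Graph n
pathAdj n i j = ⌊ toℕ j ℕ.≟ suc (toℕ i) ⌋ ∨ ⌊ toℕ i ℕ.≟ suc (toℕ j) ⌋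

-- C_n : edges {v_i,v_j}, i<j, j-i ≡ ±1 (mod n)
cycCond : (n : ℕ) → ℕ → ℕ → Bool   -- for i < j
cycCond n i j = ⌊ n ∣? ((j ∸ i) ∸ 1) ⌋ ∨ ⌊ n ∣? ((j ∸ i) ℕ.+ 1) ⌋

cycAdj : (n : ℕ) → Graph n
cycAdj n i j =
  (⌊ toℕ i ℕ.<? toℕ j ⌋ ∧ cycCond n (toℕ i) (toℕ j))
  ∨ (⌊ toℕ j ℕ.<? toℕ i ⌋ ∧ cycCond n (toℕ j) (toℕ i))

complAdj : (m : ℕ) → Graph m
complAdj m a b = not ⌊ a ≟F b ⌋

prodAdj : {n m : ℕ} → Graph n → Graph m → Fin n × Fin m → Fin n × Fin m → Bool
prodAdj g h (i , a) (j , b) = (⌊ i ≟F j ⌋ ∧ h a b) ∨ (⌊ a ≟F b ⌋ ∧ g i j)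

-- a vertex subset of Fin n × Fin m: I[i][a] = true iff (i,a) ∈ I
VSubset : ℕ → ℕ → Set
VSubset n m = Vec (Vec Bool m) n

mem : {n m : ℕ} → VSubset n m → Fin n → Fin m → Bool
mem I i a = lookup (lookup I i) a

size : {n m : ℕ} → VSubset n m → ℕ
size I = countT (List.concatMap toList (toList I))

independent : {n m : ℕ} → (Fin n × Fin m → Fin n × Fin m → Bool) → VSubset n m → Bool
independent {n} {m} adj I =
  all (λ i → all (λ a → all (λ j → all (λ b →
    not (mem I i a ∧ mem I j b ∧ adj (i , a) (j , b)))
    (allFin m)) (allFin n)) (allFin m)) (allFin n)

indepPoly : {n m : ℕ} → (Fin n × Fin m → Fin n × Fin m → Bool) → ℤ → ℤ
indepPoly {n} {m} adj r =
  sumℤ (map (λ I → r ^ℤ size I) (filter (λ I → independent adj I ≟b true) (allVec (allVec bools m) n)))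
  where
  open import Data.Bool using () renaming (_≟_ to _≟b_)

Y₁ : (n m : ℕ) → ℤ → ℤ
Y₁ n m = indepPoly (prodAdj (pathAdj n) (complAdj m))

Y₂ : (n m : ℕ) → ℤ → ℤ
Y₂ n m = indepPoly (prodAdj (cycAdj n) (complAdj m))

-- The G-polynomials. S ⊆ {1..n} represented by Vec Bool n (entry k ↔ element k+1)

σ : {n : ℕ} → Vec Bool n → ℕ
σ S = go 1 (toList S)
  where
  go : ℕ → List Bool → ℕ
  go k []           = 0
  go k (true ∷ bs)  = k ℕ.+ go (suc k) bs
  go k (false ∷ bs) = go (suc k) bs

runsFrom : Bool → List Bool → ℕ
runsFrom prev []       = 0
runsFrom prev (b ∷ bs) = (if b ∧ not prev then 1 else 0) ℕ.+ runsFrom b bs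

runs : {n : ℕ} → Vec Bool n → ℕ
runs S = runsFrom false (toList S)

lastB : List Bool → Bool
lastB []           = false
lastB (b ∷ [])     = b
lastB (_ ∷ b ∷ bs) = lastB (b ∷ bs)

-- c_o(S): number of maximal cyclic runs (meaningful for S ≠ full set)
cycRuns : {n : ℕ} → Vec Bool n → ℕ
cycRuns S = runsFrom (lastB (toList S)) (toList S)

card : {n : ℕ} → Vec Bool n → ℕ
card S = countT (toList S)

isFull : {n : ℕ} → Vec Bool n → Bool
isFull S = all (λ b → b) (toList S)

Gseg : (n : ℕ) → (m r s : ℤ) → ℤ
Gseg n m r s = sumℤ (map term (allVec bools n))
  where
  term : Vec Bool n → ℤ
  term S = (s ^ℤ σ S) * (r ^ℤ card S) * (m ^ℤ runs S) * ((m - + 1) ^ℤ (card S ∸ runs S))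

PS : (n : ℕ) → ℤ → Vec Bool n → ℤ
PS n m S = if isFull S
  then ((m - + 1) ^ℤ n) + ((- + 1) ^ℤ n) * (m - + 1)
  else (m ^ℤ cycRuns S) * ((m - + 1) ^ℤ (card S ∸ cycRuns S))

Gcirc : (n : ℕ) → (m r s : ℤ) → ℤ
Gcirc zero m r s = Gseg zero m r s
Gcirc (suc zero) m r s = Gseg (suc zero) m r s
Gcirc (suc (suc zero)) m r s = Gseg (suc (suc zero)) m r s
Gcirc n@(suc (suc (suc _))) m r s =
  sumℤ (map (λ S → (s ^ℤ σ S) * (r ^ℤ card S) * PS n m S) (allVec bools n))

-- An independent set of G × K_m is a choice of one row of columns per vertex of G, each row
-- holding at most one column and rows over adjacent vertices holding different columns.
-- Along a path, summing out one row at a time (a transfer-matrix computation), the weight of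
-- the rest depends on the previous row only through its number c of free columns (m if it is
-- empty, m - 1 if not), so it obeys chainPoly (k+1) c = chainPoly k m + r c chainPoly k (m-1).
-- Summing G^(s) one position at a time gives the same recurrence, since m^c(S) (m-1)^(|S|-c(S))
-- charges m for the first and m - 1 for every later element of a run.  On the cycle the first
-- row is fixed and the last row must avoid its column; tracking whether that column is taken
-- produces the (-r)^k corrections of avoidPoly, which match the term (-1)^n (m-1) of the
-- chromatic polynomial of C_n in P_S for the full set.

module Submission where

open import Defs
open import Data.Bool using (Bool; true; false; T; _∧_; not; if_then_else_)
open import Data.Bool.Properties using (T-∧; T-∨; T-≡; ⇔→≡; ∧-identityʳ) renaming (_≟_ to _≟ᵇ_)
open import Data.Empty using (⊥; ⊥-elim)
open import Data.Fin as Fin using (Fin; toℕ)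
import Data.Fin.Properties as Finₚ
open import Data.Integer using (ℤ; +_; _+_; _*_; -_; _-_)
import Data.Integer.Properties as ℤₚ
open import Data.Integer.Tactic.RingSolver using (solve-∀)
open import Data.List using (List; []; _∷_; _++_; map; concatMap; filter; tabulate)
open import Data.List.Relation.Unary.All using (All; []; _∷_)
open import Data.Nat as ℕ using (ℕ; zero; suc; _∸_; _≤_; z≤n; s≤s)
open import Data.Nat.Divisibility using (_∣_; _∣?_; ∣⇒≤; >⇒∤; _∣0; ∣-reflexive)
import Data.Nat.Properties as ℕₚ
open import Data.Product using (_×_; _,_; proj₁; proj₂)
open import Data.Product.Function.NonDependent.Propositional using (_×-⇔_)
open import Data.Sum as Sum using (_⊎_; inj₁; inj₂)
open import Data.Sum.Function.Propositional using (_⊎-⇔_)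
open import Data.Unit using (tt)
open import Data.Vec using (Vec; []; _∷_; lookup; toList; replicate)
open import Data.Vec.Properties using (lookup-replicate)
open import Function using (_∘_)
open import Function.Bundles using (_⇔_; mk⇔; module Equivalence)
open import Function.Properties.Equivalence using () renaming (refl to ⇔-refl; sym to ⇔-sym; trans to ⇔-trans)
open import Level using (0ℓ)
open import Relation.Binary.Core using (Rel)
open import Relation.Binary.PropositionalEquality using (_≡_; refl; sym; trans; cong; cong₂; subst; subst₂; module ≡-Reasoning)
open import Relation.Nullary using (¬_; yes; no)
open import Relation.Nullary.Decidable using (⌊_⌋; toWitness; fromWitness)

open Equivalence using (to; from)

∑ : {A : Set} → (A → ℤ) → List A → ℤ
∑ f xs = sumℤ (map f xs)

when : Bool → ℤ → ℤ
when b x = if b then x else + 0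

module _ {A : Set} where

  ∑-++ : (f : A → ℤ) (xs ys : List A) → ∑ f (xs ++ ys) ≡ ∑ f xs + ∑ f ys
  ∑-++ f []       ys = sym (ℤₚ.+-identityˡ _)
  ∑-++ f (x ∷ xs) ys = trans (cong (_+_ (f x)) (∑-++ f xs ys)) (sym (ℤₚ.+-assoc (f x) _ _))

  ∑-cong : {f g : A → ℤ} → (∀ x → f x ≡ g x) → (xs : List A) → ∑ f xs ≡ ∑ g xs
  ∑-cong f≗g []       = refl
  ∑-cong f≗g (x ∷ xs) = cong₂ _+_ (f≗g x) (∑-cong f≗g xs)

  ∑-congᴬ : {P : A → Set} {f g : A → ℤ} → (∀ {x} → P x → f x ≡ g x) →
            {xs : List A} → All P xs → ∑ f xs ≡ ∑ g xs
  ∑-congᴬ f≗g []         = refl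
  ∑-congᴬ f≗g (px ∷ pxs) = cong₂ _+_ (f≗g px) (∑-congᴬ f≗g pxs)

  ∑-zero : (xs : List A) → ∑ (λ _ → + 0) xs ≡ + 0
  ∑-zero []       = refl
  ∑-zero (x ∷ xs) = trans (ℤₚ.+-identityˡ _) (∑-zero xs)

  ∑-+ : (f g : A → ℤ) (xs : List A) → ∑ (λ x → f x + g x) xs ≡ ∑ f xs + ∑ g xs
  ∑-+ f g []       = refl
  ∑-+ f g (x ∷ xs) = trans (cong (_+_ (f x + g x)) (∑-+ f g xs)) (swap (f x) (g x) _ _)
    where
    swap : ∀ a b c d → a + b + (c + d) ≡ a + c + (b + d)
    swap = solve-∀

  ∑-*ˡ : (c : ℤ) (f : A → ℤ) (xs : List A) → ∑ (λ x → c * f x) xs ≡ c * ∑ f xs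
  ∑-*ˡ c f []       = sym (ℤₚ.*-zeroʳ c)
  ∑-*ˡ c f (x ∷ xs) = trans (cong (_+_ (c * f x)) (∑-*ˡ c f xs)) (sym (ℤₚ.*-distribˡ-+ c (f x) _))

  ∑-when : (b : Bool) (f : A → ℤ) (xs : List A) → ∑ (λ x → when b (f x)) xs ≡ when b (∑ f xs)
  ∑-when true  f xs = refl
  ∑-when false f xs = ∑-zero xs

  ∑-filter : (p : A → Bool) (f : A → ℤ) (xs : List A) →
             sumℤ (map f (filter (λ x → p x ≟ᵇ true) xs)) ≡ ∑ (λ x → when (p x) (f x)) xs
  ∑-filter p f []       = refl
  ∑-filter p f (x ∷ xs) with p x
  ... | true  = cong (_+_ (f x)) (∑-filter p f xs)
  ... | false = trans (∑-filter p f xs) (sym (ℤₚ.+-identityˡ _))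

∑-map : {A B : Set} (f : B → ℤ) (g : A → B) (xs : List A) → ∑ f (map g xs) ≡ ∑ (λ x → f (g x)) xs
∑-map f g []       = refl
∑-map f g (x ∷ xs) = cong (_+_ (f (g x))) (∑-map f g xs)

∑-concatMap : {A B : Set} (f : B → ℤ) (g : A → List B) (xs : List A) →
              ∑ f (concatMap g xs) ≡ ∑ (λ x → ∑ f (g x)) xs
∑-concatMap f g []       = refl
∑-concatMap f g (x ∷ xs) = trans (∑-++ f (g x) _) (cong (_+_ (∑ f (g x))) (∑-concatMap f g xs))

∑-allVec : {A : Set} (xs : List A) (k : ℕ) (f : Vec A (suc k) → ℤ) →
           ∑ f (allVec xs (suc k)) ≡ ∑ (λ x → ∑ (λ v → f (x ∷ v)) (allVec xs k)) xs
∑-allVec xs k f = trans (∑-concatMap f _ xs) (∑-cong (λ x → ∑-map f (x ∷_) (allVec xs k)) xs)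

∑-bools : (k : ℕ) (f : Vec Bool (suc k) → ℤ) →
          ∑ f (allVec bools (suc k)) ≡ ∑ (λ v → f (false ∷ v)) (allVec bools k) + ∑ (λ v → f (true ∷ v)) (allVec bools k)
∑-bools k f = trans (∑-allVec bools k f) (cong (_+_ (∑ (λ v → f (false ∷ v)) (allVec bools k))) (ℤₚ.+-identityʳ _))

^ℤ-zeroˡ : ∀ n → (+ 1) ^ℤ n ≡ + 1
^ℤ-zeroˡ zero    = refl
^ℤ-zeroˡ (suc n) = trans (ℤₚ.*-identityˡ _) (^ℤ-zeroˡ n)

^ℤ-distribˡ-+-* : ∀ x a b → x ^ℤ (a ℕ.+ b) ≡ x ^ℤ a * x ^ℤ b
^ℤ-distribˡ-+-* x zero    b = sym (ℤₚ.*-identityˡ _)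
^ℤ-distribˡ-+-* x (suc a) b = trans (cong (_*_ x) (^ℤ-distribˡ-+-* x a b)) (sym (ℤₚ.*-assoc x _ _))

^ℤ-distribʳ-* : ∀ x y n → (x * y) ^ℤ n ≡ x ^ℤ n * y ^ℤ n
^ℤ-distribʳ-* x y zero    = refl
^ℤ-distribʳ-* x y (suc n) = trans (cong (_*_ (x * y)) (^ℤ-distribʳ-* x y n)) (shuffle x y _ _)
  where
  shuffle : ∀ a b c d → a * b * (c * d) ≡ a * c * (b * d)
  shuffle = solve-∀

when-*ʳ : ∀ b x w → when b (x * w) ≡ x * when b w
when-*ʳ true  x w = refl
when-*ʳ false x w = sym (ℤₚ.*-zeroʳ x)

when-∧-* : ∀ a d c e x w → when ((a ∧ (d ∧ c)) ∧ e) (x * w) ≡ when a (when d (x * when (c ∧ e) w))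
when-∧-* false d     c e x w = refl
when-∧-* true  false c e x w = refl
when-∧-* true  true  c e x w = when-*ʳ (c ∧ e) x w

-- Rows: subsets of the columns of K_m

Row : ℕ → Set
Row = Vec Bool

∅ : (m : ℕ) → Row m
∅ m = replicate m false

allFalse : ∀ {m} → Row m → Bool
allFalse []      = true
allFalse (b ∷ y) = not b ∧ allFalse y

atMostOne : ∀ {m} → Row m → Bool
atMostOne []          = true
atMostOne (false ∷ y) = atMostOne y
atMostOne (true ∷ y)  = allFalse y

disjoint : ∀ {m} → Row m → Row m → Bool
disjoint []          []      = true
disjoint (false ∷ x) (_ ∷ y) = disjoint x y
disjoint (true ∷ x)  (b ∷ y) = not b ∧ disjoint x y

holes : ∀ {m} → Row m → ℕ
holes []          = 0
holes (false ∷ y) = suc (holes y)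
holes (true ∷ y)  = holes y

singletons : (m : ℕ) → List (Row m)
singletons zero    = []
singletons (suc m) = (true ∷ ∅ m) ∷ map (false ∷_) (singletons m)

data IsSingleton : ∀ {m} → Row m → Set where
  here  : ∀ {m} → IsSingleton (true ∷ ∅ m)
  there : ∀ {m} {y : Row m} → IsSingleton y → IsSingleton (false ∷ y)

card-∅ : ∀ m → card (∅ m) ≡ 0
card-∅ zero    = refl
card-∅ (suc m) = card-∅ m

holes-∅ : ∀ m → holes (∅ m) ≡ m
holes-∅ zero    = refl
holes-∅ (suc m) = cong suc (holes-∅ m)

disjoint-∅ʳ : ∀ {m} (x : Row m) → disjoint x (∅ m) ≡ true
disjoint-∅ʳ []          = refl
disjoint-∅ʳ (false ∷ x) = disjoint-∅ʳ x
disjoint-∅ʳ (true ∷ x)  = disjoint-∅ʳ x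

disjoint-∅ˡ : ∀ {m} (y : Row m) → disjoint (∅ m) y ≡ true
disjoint-∅ˡ []      = refl
disjoint-∅ˡ (_ ∷ y) = disjoint-∅ˡ y

allSingletons : ∀ m → All IsSingleton (singletons m)
allSingletons zero    = []
allSingletons (suc m) = here ∷ shift (allSingletons m)
  where
  shift : ∀ {ys : List (Row m)} → All IsSingleton ys → All IsSingleton (map (false ∷_) ys)
  shift []       = []
  shift (p ∷ ps) = there p ∷ shift ps

card-singleton : ∀ {m} {s : Row m} → IsSingleton s → card s ≡ 1
card-singleton (here {m}) = cong suc (card-∅ m)
card-singleton (there p)  = card-singleton p

holes-singleton : ∀ {m} {s : Row (suc m)} → IsSingleton s → holes s ≡ m
holes-singleton (here {m})             = holes-∅ m
holes-singleton {suc m} (there p)      = cong suc (holes-singleton p)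

disjoint-singleton-self : ∀ {m} {s : Row m} → IsSingleton s → disjoint s s ≡ false
disjoint-singleton-self here      = refl
disjoint-singleton-self (there p) = disjoint-singleton-self p

∑-allFalse : ∀ m (f : Row m → ℤ) → ∑ (λ y → when (allFalse y) (f y)) (allVec bools m) ≡ f (∅ m)
∑-allFalse zero    f = ℤₚ.+-identityʳ _
∑-allFalse (suc m) f = begin
  ∑ (λ y → when (allFalse y) (f y)) (allVec bools (suc m))
    ≡⟨ ∑-bools m _ ⟩
  ∑ (λ y → when (allFalse y) (f (false ∷ y))) (allVec bools m) + ∑ (λ _ → + 0) (allVec bools m)
    ≡⟨ cong₂ _+_ (∑-allFalse m (λ y → f (false ∷ y))) (∑-zero (allVec bools m)) ⟩
  f (∅ (suc m)) + + 0
    ≡⟨ ℤₚ.+-identityʳ _ ⟩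
  f (∅ (suc m)) ∎
  where open ≡-Reasoning

∑-atMostOne : ∀ m (f : Row m → ℤ) →
              ∑ (λ y → when (atMostOne y) (f y)) (allVec bools m) ≡ f (∅ m) + ∑ f (singletons m)
∑-atMostOne zero    f = refl
∑-atMostOne (suc m) f = begin
  ∑ (λ y → when (atMostOne y) (f y)) (allVec bools (suc m))
    ≡⟨ ∑-bools m _ ⟩
  ∑ (λ y → when (atMostOne y) (f (false ∷ y))) (allVec bools m) + ∑ (λ y → when (allFalse y) (f (true ∷ y))) (allVec bools m)
    ≡⟨ cong₂ _+_ (∑-atMostOne m (λ y → f (false ∷ y))) (∑-allFalse m (λ y → f (true ∷ y))) ⟩
  f (∅ (suc m)) + ∑ (λ y → f (false ∷ y)) (singletons m) + f (true ∷ ∅ m)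
    ≡⟨ swap (f (∅ (suc m))) (∑ (λ y → f (false ∷ y)) (singletons m)) (f (true ∷ ∅ m)) ⟩
  f (∅ (suc m)) + (f (true ∷ ∅ m) + ∑ (λ y → f (false ∷ y)) (singletons m))
    ≡⟨ cong (λ t → f (∅ (suc m)) + (f (true ∷ ∅ m) + t)) (sym (∑-map f (false ∷_) (singletons m))) ⟩
  f (∅ (suc m)) + ∑ f (singletons (suc m)) ∎
  where
  open ≡-Reasoning
  swap : ∀ a b c → a + b + c ≡ a + (c + b)
  swap = solve-∀

∑-singletons-const : ∀ {m} (x : Row m) (c : ℤ) →
                     ∑ (λ s → when (disjoint x s) c) (singletons m) ≡ + holes x * c
∑-singletons-const []                  c = refl
∑-singletons-const {suc m} (false ∷ x) c rewrite disjoint-∅ʳ x =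
  trans (cong (_+_ c) (trans (∑-map _ (false ∷_) (singletons m)) (∑-singletons-const x c)))
        (suc-* c (+ holes x))
  where
  suc-* : ∀ c h → c + h * c ≡ (+ 1 + h) * c
  suc-* = solve-∀
∑-singletons-const {suc m} (true ∷ x)  c =
  trans (ℤₚ.+-identityˡ _) (trans (∑-map _ (false ∷_) (singletons m)) (∑-singletons-const x c))

∑-singletons-∅ : ∀ {m} (x : Row m) (h : Bool → ℤ) →
                 ∑ (λ s → when (disjoint x s) (h (disjoint s (∅ m)))) (singletons m) ≡ + holes x * h true
∑-singletons-∅ x h =
  trans (∑-cong (λ s → cong (λ d → when (disjoint x s) (h d)) (disjoint-∅ʳ s)) (singletons _))
        (∑-singletons-const x (h true))

∑-singletons-disjoint : ∀ {m} (x : Row m) {z : Row m} → IsSingleton z → (h : Bool → ℤ) →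
  ∑ (λ s → when (disjoint x s) (h (disjoint s z))) (singletons m)
    ≡ + holes x * h true + when (disjoint x z) (h false - h true)
∑-singletons-disjoint {suc m} (false ∷ x) here h rewrite disjoint-∅ʳ x =
  trans (cong (_+_ (h false)) (trans (∑-map _ (false ∷_) (singletons m)) (∑-singletons-∅ x h)))
        (split (h false) (h true) (+ holes x))
  where
  split : ∀ a b c → a + c * b ≡ (+ 1 + c) * b + (a - b)
  split = solve-∀
∑-singletons-disjoint {suc m} (true ∷ x) here h =
  trans (ℤₚ.+-identityˡ _) (trans (trans (∑-map _ (false ∷_) (singletons m)) (∑-singletons-∅ x h))
        (sym (ℤₚ.+-identityʳ _)))
∑-singletons-disjoint {suc m} (false ∷ x) (there {y = z} p) h rewrite disjoint-∅ʳ x | disjoint-∅ˡ z =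
  trans (cong (_+_ (h true)) (trans (∑-map _ (false ∷_) (singletons m)) (∑-singletons-disjoint x p h)))
        (split (h true) (+ holes x) _)
  where
  split : ∀ a b c → a + (b * a + c) ≡ (+ 1 + b) * a + c
  split = solve-∀
∑-singletons-disjoint {suc m} (true ∷ x) (there p) h =
  trans (ℤₚ.+-identityˡ _) (trans (∑-map _ (false ∷_) (singletons m)) (∑-singletons-disjoint x p h))

countT-++ : ∀ xs ys → countT (xs ++ ys) ≡ countT xs ℕ.+ countT ys
countT-++ []           ys = refl
countT-++ (true ∷ xs)  ys = cong suc (countT-++ xs ys)
countT-++ (false ∷ xs) ys = countT-++ xs ys

size-∷ : ∀ {m k} (y : Row m) (I : Vec (Row m) k) → size (y ∷ I) ≡ card y ℕ.+ size I
size-∷ y I = countT-++ (toList y) _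

-- Reading off independence

AtMostOne : ∀ {m} → Row m → Set
AtMostOne y = ∀ a b → T (lookup y a) → T (lookup y b) → a ≡ b

Disjoint : ∀ {m} → Row m → Row m → Set
Disjoint x y = ∀ a → T (lookup x a) → T (lookup y a) → ⊥

T-not : ∀ b → T (not b) ⇔ (¬ T b)
T-not false = mk⇔ (λ _ ()) (λ _ → tt)
T-not true  = mk⇔ (λ ()) (λ ¬t → ¬t tt)

T-allFalse : ∀ {m} (y : Row m) → T (allFalse y) ⇔ (∀ a → ¬ T (lookup y a))
T-allFalse []          = mk⇔ (λ _ ()) (λ _ → tt)
T-allFalse (true ∷ y)  = mk⇔ (λ ()) (λ none → none Fin.zero tt)
T-allFalse (false ∷ y) = mk⇔ onTail (λ none → from (T-allFalse y) (none ∘ Fin.suc))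
  where
  onTail : T (allFalse y) → ∀ a → ¬ T (lookup (false ∷ y) a)
  onTail t (Fin.suc a) = to (T-allFalse y) t a

T-atMostOne : ∀ {m} (y : Row m) → T (atMostOne y) ⇔ AtMostOne y
T-atMostOne []          = mk⇔ (λ _ ()) (λ _ → tt)
T-atMostOne (false ∷ y) = mk⇔ onTail (λ h → from (T-atMostOne y) (λ a b ta tb → Finₚ.suc-injective (h (Fin.suc a) (Fin.suc b) ta tb)))
  where
  onTail : T (atMostOne y) → AtMostOne (false ∷ y)
  onTail t (Fin.suc a) (Fin.suc b) ta tb = cong Fin.suc (to (T-atMostOne y) t a b ta tb)
T-atMostOne (true ∷ y)  = mk⇔ onlyHead (λ h → from (T-allFalse y) (λ a ta → Finₚ.0≢1+n (h Fin.zero (Fin.suc a) tt ta)))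
  where
  onlyHead : T (allFalse y) → AtMostOne (true ∷ y)
  onlyHead t Fin.zero    Fin.zero    _  _  = refl
  onlyHead t Fin.zero    (Fin.suc b) _  tb = ⊥-elim (to (T-allFalse y) t b tb)
  onlyHead t (Fin.suc a) _           ta _  = ⊥-elim (to (T-allFalse y) t a ta)

Disjoint-∷ : ∀ {m a b} {x y : Row m} → (T a → T b → ⊥) → Disjoint x y ⇔ Disjoint (a ∷ x) (b ∷ y)
Disjoint-∷ {a = a} {b} {x} {y} head = mk⇔ extend (λ h i → h (Fin.suc i))
  where
  extend : Disjoint x y → Disjoint (a ∷ x) (b ∷ y)
  extend h Fin.zero    = head
  extend h (Fin.suc i) = h i

T-disjoint : ∀ {m} (x y : Row m) → T (disjoint x y) ⇔ Disjoint x y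
T-disjoint []          []          = mk⇔ (λ _ ()) (λ _ → tt)
T-disjoint (true ∷ x)  (true ∷ y)  = mk⇔ (λ ()) (λ h → h Fin.zero tt tt)
T-disjoint (false ∷ x) (b ∷ y)     = ⇔-trans (T-disjoint x y) (Disjoint-∷ (λ ()))
T-disjoint (true ∷ x)  (false ∷ y) = ⇔-trans (T-disjoint x y) (Disjoint-∷ (λ _ ()))

T-all-tabulate : ∀ {A : Set} {n} (p : A → Bool) (f : Fin n → A) → T (all p (tabulate f)) ⇔ (∀ i → T (p (f i)))
T-all-tabulate {n = zero}  p f = mk⇔ (λ _ ()) (λ _ → tt)
T-all-tabulate {n = suc n} p f = mk⇔ split (λ h → from T-∧ (h Fin.zero , from rest (h ∘ Fin.suc)))
  where
  rest : T (all p (tabulate (f ∘ Fin.suc))) ⇔ (∀ i → T (p (f (Fin.suc i))))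
  rest = T-all-tabulate p (f ∘ Fin.suc)
  split : T (all p (tabulate f)) → ∀ i → T (p (f i))
  split t Fin.zero    = proj₁ (to T-∧ t)
  split t (Fin.suc i) = to rest (proj₂ (to T-∧ t)) i

T-prodAdj : ∀ {n m} (g : Graph n) (i j : Fin n) (a b : Fin m) →
  T (prodAdj g (complAdj m) (i , a) (j , b)) ⇔ ((i ≡ j × ¬ a ≡ b) ⊎ (a ≡ b × T (g i j)))
T-prodAdj g i j a b with i Finₚ.≟ j | a Finₚ.≟ b
... | yes i≡j | yes a≡b = mk⇔ (λ t → inj₂ (a≡b , t)) λ { (inj₁ (_ , a≢b)) → ⊥-elim (a≢b a≡b) ; (inj₂ (_ , t)) → t }
... | yes i≡j | no a≢b  = mk⇔ (λ _ → inj₁ (i≡j , a≢b)) (λ _ → tt)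
... | no i≢j  | yes a≡b = mk⇔ (λ t → inj₂ (a≡b , t)) λ { (inj₁ (i≡j , _)) → ⊥-elim (i≢j i≡j) ; (inj₂ (_ , t)) → t }
... | no i≢j  | no a≢b  = mk⇔ (λ ()) λ { (inj₁ (i≡j , _)) → ⊥-elim (i≢j i≡j) ; (inj₂ (a≡b , _)) → ⊥-elim (a≢b a≡b) }

EdgesOf : ∀ {n} → Graph n → Rel (Fin n) 0ℓ → Set
EdgesOf g R = ∀ i j → T (g i j) ⇔ (R i j ⊎ R j i)

RowsAtMostOne : ∀ {n m} → Vec (Row m) n → Set
RowsAtMostOne I = ∀ i → AtMostOne (lookup I i)

DisjointAlong : ∀ {n m} → Rel (Fin n) 0ℓ → Vec (Row m) n → Set
DisjointAlong R I = ∀ i j → R i j → Disjoint (lookup I i) (lookup I j)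

T-independent : ∀ {n m} {g : Graph n} {R : Rel (Fin n) 0ℓ} → EdgesOf g R → (I : Vec (Row m) n) →
  T (independent (prodAdj g (complAdj m)) I) ⇔ (RowsAtMostOne I × DisjointAlong R I)
T-independent {n} {m} {g} {R} edges I = mk⇔ decode encode
  where
  adj : Fin n × Fin m → Fin n × Fin m → Bool
  adj = prodAdj g (complAdj m)
  Clash : Fin n → Fin m → Fin n → Fin m → Bool
  Clash i a j b = mem I i a ∧ mem I j b ∧ adj (i , a) (j , b)
  unfold : T (independent adj I) ⇔ (∀ i a j b → ¬ T (Clash i a j b))
  unfold = mk⇔
    (λ t i a j b → to (T-not _) (to (T-all-tabulate _ _) (to (T-all-tabulate _ _) (to (T-all-tabulate _ _) (to (T-all-tabulate _ _) t i) a) j) b))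
    (λ h → from (T-all-tabulate _ _) λ i → from (T-all-tabulate _ _) λ a → from (T-all-tabulate _ _) λ j →
             from (T-all-tabulate _ _) λ b → from (T-not _) (h i a j b))
  clash : ∀ {i a j b} → T (mem I i a) → T (mem I j b) → T (adj (i , a) (j , b)) → T (Clash i a j b)
  clash ta tb tadj = from T-∧ (ta , from T-∧ (tb , tadj))
  decode : T (independent adj I) → RowsAtMostOne I × DisjointAlong R I
  decode t = rows , along
    where
    free : ∀ i a j b → ¬ T (Clash i a j b)
    free = to unfold t
    rows : RowsAtMostOne I
    rows i a b ta tb with a Finₚ.≟ b
    ... | yes a≡b = a≡b
    ... | no a≢b  = ⊥-elim (free i a i b (clash ta tb (from (T-prodAdj g i i a b) (inj₁ (refl , a≢b)))))
    along : DisjointAlong R I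
    along i j Rij a ta tb = free i a j a (clash ta tb (from (T-prodAdj g i j a a) (inj₂ (refl , from (edges i j) (inj₁ Rij)))))
  encode : RowsAtMostOne I × DisjointAlong R I → T (independent adj I)
  encode (rows , along) = from unfold noClash
    where
    noClash : ∀ i a j b → ¬ T (Clash i a j b)
    noClash i a j b t with to T-∧ t
    ... | ta , rest with to T-∧ rest
    ...   | tb , tadj with to (T-prodAdj g i j a b) tadj
    ...     | inj₁ (refl , a≢b) = a≢b (rows i a b ta tb)
    ...     | inj₂ (refl , tg) with to (edges i j) tg
    ...       | inj₁ Rij = along i j Rij a ta tb
    ...       | inj₂ Rji = along j i Rji a tb ta

chain : ∀ {m k} → Row m → Vec (Row m) k → Bool
chain x []      = true
chain x (y ∷ I) = atMostOne y ∧ (disjoint x y ∧ chain y I)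

lastRow : ∀ {m k} → Row m → Vec (Row m) k → Row m
lastRow x []      = x
lastRow x (y ∷ I) = lastRow y I

T-injective : ∀ {a b} → T a ⇔ T b → a ≡ b
T-injective a⇔b = ⇔→≡ (⇔-trans (⇔-sym T-≡) (⇔-trans a⇔b T-≡))

Disjoint-sym : ∀ {m} (x y : Row m) → Disjoint x y → Disjoint y x
Disjoint-sym x y h a ty tx = h a tx ty

Consecutive : ∀ {n} → Rel (Fin n) 0ℓ
Consecutive i j = toℕ j ≡ suc (toℕ i)

Wrap : ∀ {n} → Rel (Fin n) 0ℓ
Wrap {n} i j = toℕ i ≡ 0 × suc (toℕ j) ≡ n

RowsAtMostOne-∷ : ∀ {n m} {y : Row m} {I : Vec (Row m) n} → RowsAtMostOne (y ∷ I) ⇔ (AtMostOne y × RowsAtMostOne I)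
RowsAtMostOne-∷ {y = y} {I} = mk⇔ (λ h → h Fin.zero , h ∘ Fin.suc) join
  where
  join : AtMostOne y × RowsAtMostOne I → RowsAtMostOne (y ∷ I)
  join (hy , hI) Fin.zero    = hy
  join (hy , hI) (Fin.suc i) = hI i

Linked : ∀ {n m} → Vec (Row m) n → Set
Linked = DisjointAlong Consecutive

Linked-∷ : ∀ {n m} {x y : Row m} {I : Vec (Row m) n} →
  Linked (x ∷ y ∷ I) ⇔ (Disjoint x y × Linked (y ∷ I))
Linked-∷ {x = x} {y} {I} = mk⇔ (λ h → h Fin.zero (Fin.suc Fin.zero) refl , λ i j e → h (Fin.suc i) (Fin.suc j) (cong suc e)) join
  where
  join : Disjoint x y × Linked (y ∷ I) → Linked (x ∷ y ∷ I)
  join (d , h) Fin.zero    (Fin.suc Fin.zero) refl = d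
  join (d , h) (Fin.suc i) (Fin.suc j)        e    = h i j (ℕₚ.suc-injective e)

Linked-∅∷ : ∀ {n m} {I : Vec (Row m) n} → Linked I ⇔ Linked (∅ m ∷ I)
Linked-∅∷ {m = m} {I} = mk⇔ extend (λ h i j e → h (Fin.suc i) (Fin.suc j) (cong suc e))
  where
  extend : Linked I → Linked (∅ m ∷ I)
  extend h Fin.zero    j           e a t _ = subst T (lookup-replicate a false) t
  extend h (Fin.suc i) (Fin.suc j) e       = h i j (ℕₚ.suc-injective e)

T-chain : ∀ {n m} (x : Row m) (I : Vec (Row m) n) →
  T (chain x I) ⇔ (RowsAtMostOne I × Linked (x ∷ I))
T-chain x []      = mk⇔ (λ _ → (λ ()) , λ { Fin.zero Fin.zero () }) (λ _ → tt)
T-chain x (y ∷ I) = mk⇔ decode encode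
  where
  decode : T (chain x (y ∷ I)) → RowsAtMostOne (y ∷ I) × Linked (x ∷ y ∷ I)
  decode t with to T-∧ t
  ... | ty , rest with to T-∧ rest
  ...   | txy , tI with to (T-chain y I) tI
  ...     | rows , links = from RowsAtMostOne-∷ (to (T-atMostOne y) ty , rows)
                         , from Linked-∷ (to (T-disjoint x y) txy , links)
  encode : RowsAtMostOne (y ∷ I) × Linked (x ∷ y ∷ I) → T (chain x (y ∷ I))
  encode (rows , links) with to RowsAtMostOne-∷ rows | to Linked-∷ links
  ... | hy , hI | dxy , dI = from T-∧ (from (T-atMostOne y) hy , from T-∧ (from (T-disjoint x y) dxy , from (T-chain y I) (hI , dI)))

-- The edges of S_n and C_n

pathAdj-edges : ∀ n → EdgesOf (pathAdj n) Consecutive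
pathAdj-edges n i j =
  ⇔-trans (T-∨ {⌊ toℕ j ℕ.≟ suc (toℕ i) ⌋}) (mk⇔ (Sum.map toWitness toWitness) (Sum.map fromWitness fromWitness))

cycAdj≗pathAdj : ∀ {n} → n ≤ 2 → ∀ i j → cycAdj n i j ≡ pathAdj n i j
cycAdj≗pathAdj (s≤s z≤n)       Fin.zero           Fin.zero           = refl
cycAdj≗pathAdj (s≤s (s≤s z≤n)) Fin.zero           Fin.zero           = refl
cycAdj≗pathAdj (s≤s (s≤s z≤n)) Fin.zero           (Fin.suc Fin.zero) = refl
cycAdj≗pathAdj (s≤s (s≤s z≤n)) (Fin.suc Fin.zero) Fin.zero           = refl
cycAdj≗pathAdj (s≤s (s≤s z≤n)) (Fin.suc Fin.zero) (Fin.suc Fin.zero) = refl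

cycAdj-small-edges : ∀ {n} → n ≤ 2 → EdgesOf (cycAdj n) Consecutive
cycAdj-small-edges {n} n≤2 i j = subst (λ b → T b ⇔ (Consecutive i j ⊎ Consecutive j i)) (sym (cycAdj≗pathAdj n≤2 i j)) (pathAdj-edges n i j)

CycleStep : ∀ {n} → Rel (Fin n) 0ℓ
CycleStep i j = Consecutive i j ⊎ Wrap i j

suc-+-∸ : ∀ a t → suc (a ℕ.+ t) ∸ a ≡ suc t
suc-+-∸ a t = trans (cong (_∸ a) (sym (ℕₚ.+-suc a t))) (ℕₚ.m+n∸m≡n a (suc t))

cycCond-sound : ∀ N a t → suc (a ℕ.+ t) ℕ.< N → T (cycCond N a (suc (a ℕ.+ t))) →
                t ≡ 0 ⊎ (a ≡ 0 × suc (suc (a ℕ.+ t)) ≡ N)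
cycCond-sound N a t b<N c rewrite suc-+-∸ a t with to (T-∨ {⌊ N ∣? t ⌋}) c
... | inj₁ N∣t   = inj₁ (distance-1 t (toWitness N∣t) (ℕₚ.<-trans (s≤s (ℕₚ.m≤n+m t a)) b<N))
  where
  distance-1 : ∀ t → N ∣ t → t ℕ.< N → t ≡ 0
  distance-1 zero    _   _   = refl
  distance-1 (suc t) N∣t t<N = ⊥-elim (>⇒∤ t<N N∣t)
... | inj₂ N∣t+2 = inj₂ (distance-N-1 a b<N (subst (N ≤_) (cong suc (ℕₚ.+-comm t 1)) (∣⇒≤ (toWitness N∣t+2))))
  where
  distance-N-1 : ∀ a → suc (a ℕ.+ t) ℕ.< N → N ≤ suc (suc t) → a ≡ 0 × suc (suc (a ℕ.+ t)) ≡ N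
  distance-N-1 zero    b<N N≤ = refl , ℕₚ.≤-antisym b<N N≤
  distance-N-1 (suc a) b<N N≤ = ⊥-elim (ℕₚ.≤⇒≯ (ℕₚ.≤-pred (ℕₚ.≤-pred (ℕₚ.≤-trans b<N N≤))) (s≤s (ℕₚ.m≤n+m t a)))

cycCond-complete : ∀ N a b → b ≡ suc a ⊎ (a ≡ 0 × suc b ≡ N) → T (cycCond N a b)
cycCond-complete N a .(suc a) (inj₁ refl) =
  from (T-∨ {⌊ N ∣? (suc a ∸ a ∸ 1) ⌋}) (inj₁ (fromWitness (subst (λ d → N ∣ d ∸ 1) (sym (ℕₚ.m+n∸n≡m 1 a)) (N ∣0))))
cycCond-complete .(suc b) .0 b (inj₂ (refl , refl)) =
  from (T-∨ {⌊ suc b ∣? (b ∸ 1) ⌋}) (inj₂ (fromWitness (∣-reflexive (sym (ℕₚ.+-comm b 1)))))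

cycCond-⇔ : ∀ N a b → a ℕ.< b → b ℕ.< N → T (cycCond N a b) ⇔ (b ≡ suc a ⊎ (a ≡ 0 × suc b ≡ N))
cycCond-⇔ N a b a<b b<N with ℕₚ.m≤n⇒∃[o]m+o≡n a<b
... | t , refl = mk⇔ (Sum.map₁ (λ t≡0 → cong suc (trans (cong (a ℕ.+_) t≡0) (ℕₚ.+-identityʳ a))) ∘ cycCond-sound N a t b<N)
                     (cycCond-complete N a (suc (a ℕ.+ t)))

cycAdj-edges : ∀ k → EdgesOf (cycAdj (suc (suc (suc k)))) CycleStep
cycAdj-edges k i j = ⇔-trans (T-∨ {ordered i j}) (T-ordered i j ⊎-⇔ T-ordered j i)
  where
  N : ℕ
  N = suc (suc (suc k))
  ordered : Fin N → Fin N → Bool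
  ordered i j = ⌊ toℕ i ℕ.<? toℕ j ⌋ ∧ cycCond N (toℕ i) (toℕ j)
  step-< : ∀ {i j : Fin N} → CycleStep i j → toℕ i ℕ.< toℕ j
  step-< {i}     (inj₁ j≡1+i)         = subst (toℕ i ℕ.<_) (sym j≡1+i) (ℕₚ.n<1+n (toℕ i))
  step-< {i} {j} (inj₂ (i≡0 , 1+j≡N)) = subst₂ ℕ._<_ (sym i≡0) (sym (ℕₚ.suc-injective 1+j≡N)) (s≤s z≤n)
  T-ordered : ∀ i j → T (ordered i j) ⇔ CycleStep i j
  T-ordered i j = mk⇔
    (λ t → to (cycCond-⇔ N _ _ (toWitness (proj₁ (to split t))) (Finₚ.toℕ<n j)) (proj₂ (to split t)))
    (λ s → from split (fromWitness (step-< s) , from (cycCond-⇔ N _ _ (step-< s) (Finₚ.toℕ<n j)) s))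
    where
    split : T (ordered i j) ⇔ (T ⌊ toℕ i ℕ.<? toℕ j ⌋ × T (cycCond N (toℕ i) (toℕ j)))
    split = T-∧

lookup-lastRow : ∀ {m k} (x : Row m) (J : Vec (Row m) k) (j : Fin (suc k)) → toℕ j ≡ k → lookup (x ∷ J) j ≡ lastRow x J
lookup-lastRow x []      Fin.zero    _ = refl
lookup-lastRow x (y ∷ J) (Fin.suc j) e = lookup-lastRow y J j (ℕₚ.suc-injective e)

DisjointAlong-Wrap : ∀ {m k} {x : Row m} {J : Vec (Row m) k} → DisjointAlong Wrap (x ∷ J) ⇔ Disjoint (lastRow x J) x
DisjointAlong-Wrap {k = k} {x} {J} = mk⇔ closing opening
  where
  lastIndex : toℕ (Fin.fromℕ k) ≡ k
  lastIndex = Finₚ.toℕ-fromℕ k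
  closing : DisjointAlong Wrap (x ∷ J) → Disjoint (lastRow x J) x
  closing h = Disjoint-sym x (lastRow x J) (subst (Disjoint x) (lookup-lastRow x J (Fin.fromℕ k) lastIndex)
                                  (h Fin.zero (Fin.fromℕ k) (refl , cong suc lastIndex)))
  opening : Disjoint (lastRow x J) x → DisjointAlong Wrap (x ∷ J)
  opening d Fin.zero j (_ , e) = subst (Disjoint x) (sym (lookup-lastRow x J j (ℕₚ.suc-injective e))) (Disjoint-sym (lastRow x J) x d)

cyclicChain : ∀ {m k} → Vec (Row m) (suc k) → Bool
cyclicChain {m} (x ∷ J) = chain (∅ m) (x ∷ J) ∧ disjoint (lastRow x J) x

T-independent-path : ∀ {n m} {g : Graph n} → EdgesOf g Consecutive → (I : Vec (Row m) n) →
  T (independent (prodAdj g (complAdj m)) I) ⇔ T (chain (∅ m) I)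
T-independent-path {m = m} edges I =
  ⇔-trans (T-independent edges I) (⇔-trans (⇔-refl ×-⇔ Linked-∅∷) (⇔-sym (T-chain (∅ m) I)))

T-independent-cycle : ∀ {k m} {g : Graph (suc k)} → EdgesOf g CycleStep → (I : Vec (Row m) (suc k)) →
  T (independent (prodAdj g (complAdj m)) I) ⇔ T (cyclicChain I)
T-independent-cycle {m = m} edges I@(x ∷ J) = mk⇔ encode decode
  where
  encode : T (independent (prodAdj _ (complAdj m)) I) → T (cyclicChain I)
  encode t with to (T-independent edges I) t
  ... | rows , along = from T-∧
    ( from (T-chain (∅ m) I) (rows , to Linked-∅∷ (λ i j c → along i j (inj₁ c)))
    , from (T-disjoint (lastRow x J) x) (to DisjointAlong-Wrap (λ i j w → along i j (inj₂ w))))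
  decode : T (cyclicChain I) → T (independent (prodAdj _ (complAdj m)) I)
  decode t with to T-∧ t
  ... | tc , td with to (T-chain (∅ m) I) tc
  ...   | rows , links = from (T-independent edges I)
    (rows , λ i j → Sum.[ from Linked-∅∷ links i j , from DisjointAlong-Wrap (to (T-disjoint (lastRow x J) x) td) i j ])
module Recurrences (m' : ℕ) (r : ℤ) where

  m : ℕ
  m = suc m'

  chainPoly : ℕ → ℕ → ℤ
  chainPoly zero    c = + 1
  chainPoly (suc k) c = chainPoly k m + r * + c * chainPoly k m'

  avoidPoly : ℕ → ℕ → ℤ
  avoidPoly zero    c = + 1
  avoidPoly (suc k) c = avoidPoly k m + r * + c * avoidPoly k m' + (- r) ^ℤ suc k

module IndependentSets (m' : ℕ) (r : ℤ) where

  open Recurrences m' r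

  rows : (k : ℕ) → List (Vec (Row m) k)
  rows = allVec (allVec bools m)

  chainSum : Row m → Row m → ℕ → ℤ
  chainSum x z k = ∑ (λ I → when (chain x I ∧ disjoint (lastRow x I) z) (r ^ℤ size I)) (rows k)

  chainSum-∷ : ∀ k x y z →
    ∑ (λ I → when (chain x (y ∷ I) ∧ disjoint (lastRow y I) z) (r ^ℤ size (y ∷ I))) (rows k)
      ≡ when (atMostOne y) (when (disjoint x y) (r ^ℤ card y * chainSum y z k))
  chainSum-∷ k x y z = begin
    ∑ (λ I → when (chain x (y ∷ I) ∧ disjoint (lastRow y I) z) (r ^ℤ size (y ∷ I))) (rows k)
      ≡⟨ ∑-cong split (rows k) ⟩
    ∑ (λ I → when (atMostOne y) (when (disjoint x y) (r ^ℤ card y * tail I))) (rows k)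
      ≡⟨ ∑-when (atMostOne y) _ (rows k) ⟩
    when (atMostOne y) (∑ (λ I → when (disjoint x y) (r ^ℤ card y * tail I)) (rows k))
      ≡⟨ cong (when (atMostOne y)) (∑-when (disjoint x y) _ (rows k)) ⟩
    when (atMostOne y) (when (disjoint x y) (∑ (λ I → r ^ℤ card y * tail I) (rows k)))
      ≡⟨ cong (λ t → when (atMostOne y) (when (disjoint x y) t)) (∑-*ˡ (r ^ℤ card y) tail (rows k)) ⟩
    when (atMostOne y) (when (disjoint x y) (r ^ℤ card y * chainSum y z k)) ∎
    where
    open ≡-Reasoning
    tail : Vec (Row m) k → ℤ
    tail I = when (chain y I ∧ disjoint (lastRow y I) z) (r ^ℤ size I)
    split : ∀ I → when (chain x (y ∷ I) ∧ disjoint (lastRow y I) z) (r ^ℤ size (y ∷ I))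
                ≡ when (atMostOne y) (when (disjoint x y) (r ^ℤ card y * tail I))
    split I = trans (cong (λ s → when (chain x (y ∷ I) ∧ disjoint (lastRow y I) z) (r ^ℤ s)) (size-∷ y I))
                (trans (cong (when (chain x (y ∷ I) ∧ disjoint (lastRow y I) z)) (^ℤ-distribˡ-+-* r (card y) (size I)))
                  (when-∧-* (atMostOne y) (disjoint x y) (chain y I) (disjoint (lastRow y I) z) (r ^ℤ card y) (r ^ℤ size I)))

  chainSum-suc : ∀ k x z {Φ : Row m → ℤ} → (∀ y → chainSum y z k ≡ Φ y) →
    let Ψ = λ y → when (disjoint x y) (r ^ℤ card y * Φ y) in
    chainSum x z (suc k) ≡ Ψ (∅ m) + ∑ Ψ (singletons m)
  chainSum-suc k x z {Φ} closed = begin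
    chainSum x z (suc k)
      ≡⟨ ∑-allVec (allVec bools m) k (λ I → when (chain x I ∧ disjoint (lastRow x I) z) (r ^ℤ size I)) ⟩
    ∑ (λ y → ∑ (λ I → when (chain x (y ∷ I) ∧ disjoint (lastRow y I) z) (r ^ℤ size (y ∷ I))) (rows k)) (allVec bools m)
      ≡⟨ ∑-cong (λ y → trans (chainSum-∷ k x y z) (cong (λ t → when (atMostOne y) (when (disjoint x y) (r ^ℤ card y * t))) (closed y))) (allVec bools m) ⟩
    ∑ (λ y → when (atMostOne y) (when (disjoint x y) (r ^ℤ card y * Φ y))) (allVec bools m)
      ≡⟨ ∑-atMostOne m _ ⟩
    _ ∎
    where open ≡-Reasoning

  weight-∅ : ∀ x (w : ℤ) → when (disjoint x (∅ m)) (r ^ℤ card (∅ m) * w) ≡ w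
  weight-∅ x w rewrite disjoint-∅ʳ x | card-∅ m = ℤₚ.*-identityˡ w

  weight-singleton : ∀ {s : Row m} → IsSingleton s → (w : ℤ) → r ^ℤ card s * w ≡ r * w
  weight-singleton p w rewrite card-singleton p = cong (_* w) (ℤₚ.*-identityʳ r)

  chainSum-∅ : ∀ k x → chainSum x (∅ m) k ≡ chainPoly k (holes x)
  chainSum-∅ zero    x rewrite disjoint-∅ʳ x = refl
  chainSum-∅ (suc k) x = begin
    chainSum x (∅ m) (suc k)
      ≡⟨ chainSum-suc k x (∅ m) (chainSum-∅ k) ⟩
    Ψ (∅ m) + ∑ Ψ (singletons m)
      ≡⟨ cong₂ _+_ (trans (weight-∅ x _) (cong (chainPoly k) (holes-∅ m))) (∑-congᴬ onSingleton (allSingletons m)) ⟩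
    chainPoly k m + ∑ (λ s → when (disjoint x s) (r * chainPoly k m')) (singletons m)
      ≡⟨ cong (_+_ (chainPoly k m)) (∑-singletons-const x _) ⟩
    chainPoly k m + + holes x * (r * chainPoly k m')
      ≡⟨ rearrange (chainPoly k m) r (+ holes x) (chainPoly k m') ⟩
    chainPoly (suc k) (holes x) ∎
    where
    open ≡-Reasoning
    Ψ : Row m → ℤ
    Ψ y = when (disjoint x y) (r ^ℤ card y * chainPoly k (holes y))
    onSingleton : ∀ {s} → IsSingleton s → Ψ s ≡ when (disjoint x s) (r * chainPoly k m')
    onSingleton {s} p = cong (when (disjoint x s))
      (trans (weight-singleton p _) (cong (λ c → r * chainPoly k c) (holes-singleton p)))
    rearrange : ∀ a r c b → a + c * (r * b) ≡ a + r * c * b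
    rearrange = solve-∀

  chainSum-singleton : ∀ k {z} → IsSingleton z → ∀ x →
    chainSum x z k ≡ avoidPoly k (holes x) - when (not (disjoint x z)) ((- r) ^ℤ k)
  chainSum-singleton zero    {z} p x with disjoint x z
  ... | true  = refl
  ... | false = refl
  chainSum-singleton (suc k) {z} p x = begin
    chainSum x z (suc k)
      ≡⟨ chainSum-suc k x z (chainSum-singleton k p) ⟩
    Ψ (∅ m) + ∑ Ψ (singletons m)
      ≡⟨ cong₂ _+_ (trans (weight-∅ x _) onEmpty) (∑-congᴬ onSingleton (allSingletons m)) ⟩
    avoidPoly k m - + 0 + ∑ (λ s → when (disjoint x s) (h (disjoint s z))) (singletons m)
      ≡⟨ cong (_+_ (avoidPoly k m - + 0)) (∑-singletons-disjoint x p h) ⟩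
    avoidPoly k m - + 0 + (+ holes x * h true + when (disjoint x z) (h false - h true))
      ≡⟨ rearrange (disjoint x z) ⟩
    avoidPoly (suc k) (holes x) - when (not (disjoint x z)) ((- r) ^ℤ suc k) ∎
    where
    open ≡-Reasoning
    Ψ : Row m → ℤ
    Ψ y = when (disjoint x y) (r ^ℤ card y * (avoidPoly k (holes y) - when (not (disjoint y z)) ((- r) ^ℤ k)))
    h : Bool → ℤ
    h d = r * (avoidPoly k m' - when (not d) ((- r) ^ℤ k))
    onEmpty : avoidPoly k (holes (∅ m)) - when (not (disjoint (∅ m) z)) ((- r) ^ℤ k) ≡ avoidPoly k m - + 0
    onEmpty rewrite holes-∅ m | disjoint-∅ˡ z = refl
    onSingleton : ∀ {s} → IsSingleton s → Ψ s ≡ when (disjoint x s) (h (disjoint s z))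
    onSingleton {s} q = cong (when (disjoint x s))
      (trans (weight-singleton q _) (cong (λ c → r * (avoidPoly k c - when (not (disjoint s z)) ((- r) ^ℤ k))) (holes-singleton q)))
    disjointCase : ∀ a r c b p → a - + 0 + (c * (r * (b - + 0)) + (r * (b - p) - r * (b - + 0)))
                                 ≡ a + r * c * b + - r * p - + 0
    disjointCase = solve-∀
    overlapCase : ∀ a r c b p → a - + 0 + (c * (r * (b - + 0)) + + 0) ≡ a + r * c * b + - r * p - - r * p
    overlapCase = solve-∀
    rearrange : ∀ d → avoidPoly k m - + 0 + (+ holes x * h true + when d (h false - h true))
                      ≡ avoidPoly (suc k) (holes x) - when (not d) ((- r) ^ℤ suc k)
    rearrange true  = disjointCase (avoidPoly k m) r (+ holes x) (avoidPoly k m') ((- r) ^ℤ k)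
    rearrange false = overlapCase (avoidPoly k m) r (+ holes x) (avoidPoly k m') ((- r) ^ℤ k)

  cycleSum : ℕ → ℤ
  cycleSum k = ∑ (λ I → when (cyclicChain I) (r ^ℤ size I)) (rows (suc k))

  cycleSum-closed : ∀ k → cycleSum k ≡ chainPoly k m + + m * (r * (avoidPoly k m' - (- r) ^ℤ k))
  cycleSum-closed k = begin
    cycleSum k
      ≡⟨ ∑-allVec (allVec bools m) k (λ I → when (cyclicChain I) (r ^ℤ size I)) ⟩
    ∑ (λ y → ∑ (λ J → when (cyclicChain (y ∷ J)) (r ^ℤ size (y ∷ J))) (rows k)) (allVec bools m)
      ≡⟨ ∑-cong (λ y → chainSum-∷ k (∅ m) y y) (allVec bools m) ⟩
    ∑ (λ y → when (atMostOne y) (Ψ y)) (allVec bools m)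
      ≡⟨ ∑-atMostOne m Ψ ⟩
    Ψ (∅ m) + ∑ Ψ (singletons m)
      ≡⟨ cong₂ _+_ onEmpty (∑-congᴬ onSingleton (allSingletons m)) ⟩
    chainPoly k m + ∑ (λ s → when (disjoint (∅ m) s) (r * (avoidPoly k m' - (- r) ^ℤ k))) (singletons m)
      ≡⟨ cong (_+_ (chainPoly k m)) (trans (∑-singletons-const (∅ m) _) (cong (λ c → + c * (r * (avoidPoly k m' - (- r) ^ℤ k))) (holes-∅ m))) ⟩
    chainPoly k m + + m * (r * (avoidPoly k m' - (- r) ^ℤ k)) ∎
    where
    open ≡-Reasoning
    Ψ : Row m → ℤ
    Ψ y = when (disjoint (∅ m) y) (r ^ℤ card y * chainSum y y k)
    onEmpty : Ψ (∅ m) ≡ chainPoly k m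
    onEmpty = trans (weight-∅ (∅ m) _) (trans (chainSum-∅ k (∅ m)) (cong (chainPoly k) (holes-∅ m)))
    onSingleton : ∀ {s} → IsSingleton s → Ψ s ≡ when (disjoint (∅ m) s) (r * (avoidPoly k m' - (- r) ^ℤ k))
    onSingleton {s} p rewrite chainSum-singleton k p s | holes-singleton p | disjoint-singleton-self p =
      cong (when (disjoint (∅ m) s)) (weight-singleton p _)

  indepPoly-path : ∀ {n} {g : Graph n} → EdgesOf g Consecutive → indepPoly (prodAdj g (complAdj m)) r ≡ chainPoly n m
  indepPoly-path {n} {g} edges = begin
    indepPoly (prodAdj g (complAdj m)) r
      ≡⟨ ∑-filter (independent (prodAdj g (complAdj m))) (λ I → r ^ℤ size I) (rows n) ⟩
    ∑ (λ I → when (independent (prodAdj g (complAdj m)) I) (r ^ℤ size I)) (rows n)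
      ≡⟨ ∑-cong (λ I → cong (λ b → when b (r ^ℤ size I)) (isChain I)) (rows n) ⟩
    chainSum (∅ m) (∅ m) n
      ≡⟨ chainSum-∅ n (∅ m) ⟩
    chainPoly n (holes (∅ m))
      ≡⟨ cong (chainPoly n) (holes-∅ m) ⟩
    chainPoly n m ∎
    where
    open ≡-Reasoning
    isChain : ∀ I → independent (prodAdj g (complAdj m)) I ≡ chain (∅ m) I ∧ disjoint (lastRow (∅ m) I) (∅ m)
    isChain I = trans (T-injective (T-independent-path edges I))
                      (sym (trans (cong (chain (∅ m) I ∧_) (disjoint-∅ʳ (lastRow (∅ m) I))) (∧-identityʳ _)))

  indepPoly-cycle : ∀ {k} {g : Graph (suc k)} → EdgesOf g CycleStep → indepPoly (prodAdj g (complAdj m)) r ≡ cycleSum k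
  indepPoly-cycle {k} {g} edges =
    trans (∑-filter (independent (prodAdj g (complAdj m))) (λ I → r ^ℤ size I) (rows (suc k)))
          (∑-cong (λ I → cong (λ b → when b (r ^ℤ size I)) (T-injective (T-independent-cycle edges I))) (rows (suc k)))

module SubsetSums (m' : ℕ) (r : ℤ) where

  open Recurrences m' r

  colours : Bool → ℕ
  colours false = m
  colours true  = m'

  runWeight : Bool → List Bool → ℤ
  runWeight p []           = + 1
  runWeight p (false ∷ bs) = runWeight false bs
  runWeight p (true ∷ bs)  = r * + colours p * runWeight true bs

  runsFrom≤countT : ∀ p bs → runsFrom p bs ≤ countT bs
  runsFrom≤countT p     []           = z≤n
  runsFrom≤countT p     (false ∷ bs) = runsFrom≤countT false bs
  runsFrom≤countT false (true ∷ bs)  = s≤s (runsFrom≤countT true bs)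
  runsFrom≤countT true  (true ∷ bs)  = ℕₚ.m≤n⇒m≤1+n (runsFrom≤countT true bs)

  runWeight-powers : ∀ p bs →
    r ^ℤ countT bs * (+ m) ^ℤ runsFrom p bs * (+ m') ^ℤ (countT bs ∸ runsFrom p bs) ≡ runWeight p bs
  runWeight-powers p     []           = refl
  runWeight-powers p     (false ∷ bs) = runWeight-powers false bs
  runWeight-powers false (true ∷ bs)  =
    trans (newRun r (+ m) _ _ _) (cong (_*_ (r * + m)) (runWeight-powers true bs))
    where
    newRun : ∀ r c x y z → r * x * (c * y) * z ≡ r * c * (x * y * z)
    newRun = solve-∀
  runWeight-powers true  (true ∷ bs) rewrite ℕₚ.+-∸-assoc 1 (runsFrom≤countT true bs) =
    trans (sameRun r (+ m') _ _ _) (cong (_*_ (r * + m')) (runWeight-powers true bs))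
    where
    sameRun : ∀ r c x y z → r * x * y * (c * z) ≡ r * c * (x * y * z)
    sameRun = solve-∀

  ∑-runWeight : ∀ k p → ∑ (λ V → runWeight p (toList V)) (allVec bools k) ≡ chainPoly k (colours p)
  ∑-runWeight zero    p = refl
  ∑-runWeight (suc k) p = trans (∑-bools k _)
    (cong₂ _+_ (∑-runWeight k false)
               (trans (∑-*ˡ (r * + colours p) (λ V → runWeight true (toList V)) (allVec bools k))
                      (cong (_*_ (r * + colours p)) (∑-runWeight k true))))

  Gseg-closed : ∀ n → Gseg n (+ m) r (+ 1) ≡ chainPoly n m
  Gseg-closed n = trans (∑-cong term (allVec bools n)) (∑-runWeight n false)
    where
    term : ∀ (V : Vec Bool n) →
      (+ 1) ^ℤ σ V * r ^ℤ card V * (+ m) ^ℤ runs V * (+ m') ^ℤ (card V ∸ runs V) ≡ runWeight false (toList V)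
    term V rewrite ^ℤ-zeroˡ (σ V) | ℤₚ.*-identityˡ (r ^ℤ card V) = runWeight-powers false (toList V)

  lastOr : Bool → List Bool → Bool
  lastOr b []       = b
  lastOr b (c ∷ bs) = lastOr c bs

  lastB-∷ : ∀ b bs → lastB (b ∷ bs) ≡ lastOr b bs
  lastB-∷ b []       = refl
  lastB-∷ b (c ∷ bs) = lastB-∷ c bs

  isFull⇒replicate : ∀ {n} (V : Vec Bool n) → isFull V ≡ true → V ≡ replicate n true
  isFull⇒replicate []          _    = refl
  isFull⇒replicate (true ∷ V)  full = cong (true ∷_) (isFull⇒replicate V full)

  ∑-isFull : ∀ n (c : ℤ) → ∑ (λ V → when (isFull V) c) (allVec bools n) ≡ c
  ∑-isFull zero    c = ℤₚ.+-identityʳ c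
  ∑-isFull (suc n) c = trans (∑-bools n _)
    (trans (cong₂ _+_ (∑-zero (allVec bools n)) (∑-isFull n c)) (ℤₚ.+-identityˡ c))

  card-full : ∀ n → card (replicate n true) ≡ n
  card-full zero    = refl
  card-full (suc n) = cong suc (card-full n)

  lastOr-full : ∀ n → lastOr true (toList (replicate n true)) ≡ true
  lastOr-full zero    = refl
  lastOr-full (suc n) = lastOr-full n

  runWeight-full : ∀ n → runWeight true (toList (replicate n true)) ≡ (r * + m') ^ℤ n
  runWeight-full zero    = refl
  runWeight-full (suc n) = cong (_*_ (r * + m')) (runWeight-full n)

  -- The chromatic polynomial (m-1)^n + (-1)^n (m-1) of the n-cycle exceeds the weight
  -- (m-1)^n of a single cyclic run by (-1)^n (m-1).
  Gcirc-term-full : ∀ n → let F = replicate (suc n) true in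
    (+ 1) ^ℤ σ F * r ^ℤ card F * ((+ m') ^ℤ suc n + (- + 1) ^ℤ suc n * + m')
      ≡ runWeight (lastB (toList F)) (toList F) + (- r) ^ℤ suc n * + m'
  Gcirc-term-full n = begin
    (+ 1) ^ℤ σ F * r ^ℤ card F * ((+ m') ^ℤ N + (- + 1) ^ℤ N * + m')
      ≡⟨ cong₂ (λ a b → a * r ^ℤ b * ((+ m') ^ℤ N + (- + 1) ^ℤ N * + m')) (^ℤ-zeroˡ (σ F)) (card-full N) ⟩
    + 1 * r ^ℤ N * ((+ m') ^ℤ N + (- + 1) ^ℤ N * + m')
      ≡⟨ expand (r ^ℤ N) ((+ m') ^ℤ N) ((- + 1) ^ℤ N) (+ m') ⟩
    r ^ℤ N * (+ m') ^ℤ N + (- + 1) ^ℤ N * r ^ℤ N * + m'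
      ≡⟨ cong₂ (λ a b → a + b * + m') (sym (^ℤ-distribʳ-* r (+ m') N))
               (trans (sym (^ℤ-distribʳ-* (- + 1) r N)) (cong (_^ℤ N) (ℤₚ.-1*i≡-i r))) ⟩
    (r * + m') ^ℤ N + (- r) ^ℤ N * + m'
      ≡⟨ cong (λ w → w + (- r) ^ℤ N * + m') (sym (runWeight-full N)) ⟩
    runWeight true (toList F) + (- r) ^ℤ N * + m'
      ≡⟨ cong (λ p → runWeight p (toList F) + (- r) ^ℤ N * + m') (sym (trans (lastB-∷ true (toList (replicate n true))) (lastOr-full n))) ⟩
    runWeight (lastB (toList F)) (toList F) + (- r) ^ℤ N * + m' ∎
    where
    open ≡-Reasoning
    N : ℕ
    N = suc n
    F : Vec Bool N
    F = replicate N true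
    expand : ∀ a b e c → + 1 * a * (b + e * c) ≡ a * b + e * a * c
    expand = solve-∀

  Gcirc-term : ∀ n (V : Vec Bool (suc n)) →
    (+ 1) ^ℤ σ V * r ^ℤ card V * PS (suc n) (+ m) V
      ≡ runWeight (lastB (toList V)) (toList V) + when (isFull V) ((- r) ^ℤ suc n * + m')
  Gcirc-term n V with isFull V in full
  ... | false rewrite ^ℤ-zeroˡ (σ V) | ℤₚ.*-identityˡ (r ^ℤ card V) =
    trans (sym (ℤₚ.*-assoc (r ^ℤ card V) _ _))
          (trans (runWeight-powers (lastB (toList V)) (toList V)) (sym (ℤₚ.+-identityʳ _)))
  ... | true with isFull⇒replicate V full
  ...   | refl = Gcirc-term-full n

  cyclicRunSum : Bool → ℕ → ℤ
  cyclicRunSum p k = ∑ (λ V → + colours (lastOr p (toList V)) * runWeight p (toList V)) (allVec bools k)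

  cyclicRunSum-suc : ∀ p k → cyclicRunSum p (suc k) ≡ cyclicRunSum false k + r * + colours p * cyclicRunSum true k
  cyclicRunSum-suc p k = trans (∑-bools k _) (cong (_+_ (cyclicRunSum false k))
    (trans (∑-cong (λ V → pull (+ colours (lastOr true (toList V))) r (+ colours p) (runWeight true (toList V))) (allVec bools k))
           (∑-*ˡ (r * + colours p) _ (allVec bools k))))
    where
    pull : ∀ a r c w → a * (r * c * w) ≡ r * c * (a * w)
    pull = solve-∀

  cyclicRunSum-closed : ∀ k p → cyclicRunSum p k + when p ((- r) ^ℤ k) ≡ + m * avoidPoly k (colours p)
  cyclicRunSum-closed zero false = base (+ m)
    where
    base : ∀ c → c * + 1 + + 0 + + 0 ≡ c * + 1
    base = solve-∀
  cyclicRunSum-closed zero true = base (+ m')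
    where
    base : ∀ c → c * + 1 + + 0 + + 1 ≡ (+ 1 + c) * + 1
    base = solve-∀
  cyclicRunSum-closed (suc k) p = begin
    cyclicRunSum p (suc k) + when p (- r * P)
      ≡⟨ cong (_+ when p (- r * P)) (cyclicRunSum-suc p k) ⟩
    Kf + r * c * Kt + when p (- r * P)
      ≡⟨ regroup Kf Kt P r c (when p (- r * P)) ⟩
    (Kf + when false P) + r * c * (Kt + when true P) + (when p (- r * P) - r * c * P)
      ≡⟨ cong₂ (λ a b → a + r * c * b + (when p (- r * P) - r * c * P))
               (cyclicRunSum-closed k false) (cyclicRunSum-closed k true) ⟩
    + m * A + r * c * (+ m * B) + (when p (- r * P) - r * c * P)
      ≡⟨ finish p ⟩
    + m * avoidPoly (suc k) (colours p) ∎
    where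
    open ≡-Reasoning
    Kf Kt P A B c : ℤ
    Kf = cyclicRunSum false k
    Kt = cyclicRunSum true k
    P  = (- r) ^ℤ k
    A  = avoidPoly k m
    B  = avoidPoly k m'
    c  = + colours p
    regroup : ∀ Kf Kt P r c W → Kf + r * c * Kt + W ≡ (Kf + + 0) + r * c * (Kt + P) + (W - r * c * P)
    regroup = solve-∀
    -- colours p + [p] = m is what makes the correction terms collapse
    finish : ∀ p → + m * A + r * + colours p * (+ m * B) + (when p (- r * P) - r * + colours p * P)
                   ≡ + m * avoidPoly (suc k) (colours p)
    finish false = lemma (+ m) A B P r
      where
      lemma : ∀ M A B P r → M * A + r * M * (M * B) + (+ 0 - r * M * P) ≡ M * (A + r * M * B + - r * P)
      lemma = solve-∀
    finish true = lemma (+ m') A B P r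
      where
      lemma : ∀ M' A B P r → (+ 1 + M') * A + r * M' * ((+ 1 + M') * B) + (- r * P - r * M' * P)
                           ≡ (+ 1 + M') * (A + r * M' * B + - r * P)
      lemma = solve-∀

  cyclicRunWeights : ∀ n →
    ∑ (λ V → runWeight (lastB (toList V)) (toList V)) (allVec bools (suc n)) ≡ chainPoly n m + r * cyclicRunSum true n
  cyclicRunWeights n = trans (∑-bools n _) (cong₂ _+_ (∑-runWeight n false)
    (trans (∑-cong startsRun (allVec bools n)) (∑-*ˡ r _ (allVec bools n))))
    where
    startsRun : ∀ (V : Vec Bool n) → runWeight (lastB (true ∷ toList V)) (true ∷ toList V)
                                     ≡ r * (+ colours (lastOr true (toList V)) * runWeight true (toList V))
    startsRun V rewrite lastB-∷ true (toList V) = ℤₚ.*-assoc r _ _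

  Gcirc-closed : ∀ n → Gcirc (suc (suc (suc n))) (+ m) r (+ 1)
                    ≡ chainPoly (suc (suc n)) m + + m * (r * (avoidPoly (suc (suc n)) m' - (- r) ^ℤ suc (suc n)))
  Gcirc-closed n = begin
    Gcirc (suc k) (+ m) r (+ 1)
      ≡⟨ ∑-cong (Gcirc-term k) (allVec bools (suc k)) ⟩
    ∑ (λ V → runWeight (lastB (toList V)) (toList V) + when (isFull V) (- r * P * + m')) (allVec bools (suc k))
      ≡⟨ ∑-+ _ _ (allVec bools (suc k)) ⟩
    ∑ (λ V → runWeight (lastB (toList V)) (toList V)) (allVec bools (suc k)) + ∑ (λ V → when (isFull V) (- r * P * + m')) (allVec bools (suc k))
      ≡⟨ cong₂ _+_ (cyclicRunWeights k) (∑-isFull (suc k) _) ⟩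
    chainPoly k m + r * cyclicRunSum true k + - r * P * + m'
      ≡⟨ regroup (chainPoly k m) r (cyclicRunSum true k) P (+ m') ⟩
    chainPoly k m + r * (cyclicRunSum true k + P) - r * P * + m
      ≡⟨ cong (λ t → chainPoly k m + r * t - r * P * + m) (cyclicRunSum-closed k true) ⟩
    chainPoly k m + r * (+ m * avoidPoly k m') - r * P * + m
      ≡⟨ factor (chainPoly k m) r (avoidPoly k m') P (+ m) ⟩
    chainPoly k m + + m * (r * (avoidPoly k m' - P)) ∎
    where
    open ≡-Reasoning
    k : ℕ
    k = suc (suc n)
    P : ℤ
    P = (- r) ^ℤ k
    regroup : ∀ U r K P M' → U + r * K + - r * P * M' ≡ U + r * (K + P) - r * P * (+ 1 + M')
    regroup = solve-∀
    factor : ∀ U r B P M → U + r * (M * B) - r * P * M ≡ U + M * (r * (B - P))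
    factor = solve-∀

module _ (m' : ℕ) (r : ℤ) where

  open Recurrences m' r
  open IndependentSets m' r
  open SubsetSums m' r

  Y₁≡Gseg : ∀ n → Y₁ n m r ≡ Gseg n (+ m) r (+ 1)
  Y₁≡Gseg n = trans (indepPoly-path (pathAdj-edges n)) (sym (Gseg-closed n))

  Y₂≡Gcirc : ∀ n → Y₂ n m r ≡ Gcirc n (+ m) r (+ 1)
  Y₂≡Gcirc zero                = trans (indepPoly-path (cycAdj-small-edges z≤n)) (sym (Gseg-closed 0))
  Y₂≡Gcirc (suc zero)          = trans (indepPoly-path (cycAdj-small-edges (s≤s z≤n))) (sym (Gseg-closed 1))
  Y₂≡Gcirc (suc (suc zero))    = trans (indepPoly-path (cycAdj-small-edges (s≤s (s≤s z≤n)))) (sym (Gseg-closed 2))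
  Y₂≡Gcirc (suc (suc (suc k))) = begin
    Y₂ (suc (suc (suc k))) m r
      ≡⟨ indepPoly-cycle (cycAdj-edges k) ⟩
    cycleSum (suc (suc k))
      ≡⟨ cycleSum-closed (suc (suc k)) ⟩
    chainPoly (suc (suc k)) m + + m * (r * (avoidPoly (suc (suc k)) m' - (- r) ^ℤ suc (suc k)))
      ≡⟨ sym (Gcirc-closed k) ⟩
    Gcirc (suc (suc (suc k))) (+ m) r (+ 1) ∎
    where open ≡-Reasoning

mainTheorem19 : (n m : ℕ) → 1 ≤ n → 1 ≤ m → (r : ℤ) →
    (Y₁ n m r ≡ Gseg n (+ m) r (+ 1)) × (Y₂ n m r ≡ Gcirc n (+ m) r (+ 1))
mainTheorem19 n (suc m') _ _ r = Y₁≡Gseg m' r n , Y₂≡Gcirc m' r n
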